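{- Let $A$ be the sequent $\big((z\lor\neg y)\land(\neg z\lor\neg y)\big)^R$ and $B$ the sequent $\big((x\land y)\lor(\neg x\land y)\big)^R$, where $x,y,z$ are distinct variables. Then the pair $(A,B)$ is inconsistent in orthologic, but it has no refutation-based interpolant. Consequently, refutation-based interpolants do not always exist in orthologic.
   Context: Formulas of (propositional) orthologic are built from variables, $0,1$, $\land,\lor,\neg$ ($\land,\lor$ commutative). An annotated formula is $\phi^L$ or $\phi^R$; a sequent is a set of at most two annotated formulas; $\Gamma,\Delta$ denote sets of zero or one annotated formula. The proof rules are: Hyp: $\phi^L,\phi^R$. Cut: from $\Gamma,\psi^R$ and $\psi^L,\Delta$ infer $\Gamma,\Delta$. Weaken: from $\Gamma$ infer $\Gamma,\Delta$. LeftAnd: from $\Gamma,\phi^L$ infer $\Gamma,(\phi\land\psi)^L$. RightAnd: from $\Gamma,\phi^R$ and $\Gamma,\psi^R$ infer $\Gamma,(\phi\land\psi)^R$. LeftOr: from $\Gamma,\phi^L$ and $\Gamma,\psi^L$ infer $\Gamma,(\phi\lor\psi)^L$. RightOr: from $\Gamma,\phi^R$ infer $\Gamma,(\phi\lor\psi)^R$. LeftNot: from $\Gamma,\phi^R$ infer $\Gamma,(\neg\phi)^L$. RightNot: from $\Gamma,\phi^L$ infer $\Gamma,(\neg\phi)^R$. A sequent can be deduced from a set of sequents (axioms) if it has a derivation using these rules in which the given sequents may additionally be used as leaves. A pair of sequents $(A,B)$ is inconsistent if the empty sequent can be deduced from $\{A,B\}$. A refutation-based interpolant of an inconsistent pair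 $(A,B)$ is a sequent $I$ such that $I$ can be deduced from $A$ alone, the pair $(I,B)$ is inconsistent, and the free variables of $I$ are among those common to $A$ and $B$. -}

module Defs where

open import Data.Nat using (ℕ; _≤_)
open import Data.List using (List; []; _∷_; _++_; length)
open import Data.Maybe using (Maybe; nothing; just)
open import Data.Product using (Σ; _×_; _,_)
open import Data.Sum using (_⊎_)
open import Relation.Binary.PropositionalEquality using (_≡_)

infixr 7 _∧_
infixr 6 _∨_

data Formula : Set where
  var : ℕ → Formula
  𝟘 𝟙 : Formula
  _∧_ _∨_ : Formula → Formula → Formula
  ¬ᶠ_ : Formula → Formula

-- ∧ and ∨ are commutative: formulas are taken modulo the congruence
-- generated by commutativity of ∧ and ∨.
data _~_ : Formula → Formula → Set where
  ~refl  : ∀ {φ} → φ ~ φ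
  ~sym   : ∀ {φ ψ} → φ ~ ψ → ψ ~ φ
  ~trans : ∀ {φ ψ χ} → φ ~ ψ → ψ ~ χ → φ ~ χ
  ∧-comm : ∀ {φ ψ} → (φ ∧ ψ) ~ (ψ ∧ φ)
  ∨-comm : ∀ {φ ψ} → (φ ∨ ψ) ~ (ψ ∨ φ)
  ∧-cong : ∀ {φ φ' ψ ψ'} → φ ~ φ' → ψ ~ ψ' → (φ ∧ ψ) ~ (φ' ∧ ψ')
  ∨-cong : ∀ {φ φ' ψ ψ'} → φ ~ φ' → ψ ~ ψ' → (φ ∨ ψ) ~ (φ' ∨ ψ')
  ¬-cong : ∀ {φ φ'} → φ ~ φ' → (¬ᶠ φ) ~ (¬ᶠ φ')

data Ann : Set where
  _ᴸ _ᴿ : Formula → Ann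

data _≈ᴬ_ : Ann → Ann → Set where
  L~ : ∀ {φ ψ} → φ ~ ψ → (φ ᴸ) ≈ᴬ (ψ ᴸ)
  R~ : ∀ {φ ψ} → φ ~ ψ → (φ ᴿ) ≈ᴬ (ψ ᴿ)

-- A sequent is a finite set of annotated formulas, represented by a list
-- (order and multiplicity irrelevant, see _≈ˢ_). Being a sequent proper
-- means having at most two elements.
Sequent : Set
Sequent = List Ann

IsSequent : Sequent → Set
IsSequent S = length S ≤ 2

data _∈~_ (a : Ann) : Sequent → Set where
  here  : ∀ {b S} → a ≈ᴬ b → a ∈~ (b ∷ S)
  there : ∀ {b S} → a ∈~ S → a ∈~ (b ∷ S)

_≈ˢ_ : Sequent → Sequent → Set
S ≈ˢ T = (∀ a → a ∈~ S → a ∈~ T) × (∀ a → a ∈~ T → a ∈~ S)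

Ctx : Set
Ctx = Maybe Ann

⌊_⌋ : Ctx → Sequent
⌊ nothing ⌋ = []
⌊ just a ⌋ = a ∷ []

infixl 5 _,,_
_,,_ : Ctx → Ann → Sequent
Γ ,, a = ⌊ Γ ⌋ ++ (a ∷ [])

data _⊢_ (Ax : Sequent → Set) : Sequent → Set where
  axiom    : ∀ {S} → Ax S → Ax ⊢ S
  conv     : ∀ {S T} → S ≈ˢ T → Ax ⊢ S → Ax ⊢ T
  hyp      : ∀ φ → Ax ⊢ ((φ ᴸ) ∷ (φ ᴿ) ∷ [])
  cut      : ∀ {Γ Δ ψ} → Ax ⊢ (Γ ,, (ψ ᴿ)) → Ax ⊢ ((ψ ᴸ) ∷ ⌊ Δ ⌋)
             → Ax ⊢ (⌊ Γ ⌋ ++ ⌊ Δ ⌋)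
  weaken   : ∀ {Γ Δ} → Ax ⊢ ⌊ Γ ⌋ → Ax ⊢ (⌊ Γ ⌋ ++ ⌊ Δ ⌋)
  leftAnd  : ∀ {Γ φ ψ} → Ax ⊢ (Γ ,, (φ ᴸ)) → Ax ⊢ (Γ ,, ((φ ∧ ψ) ᴸ))
  rightAnd : ∀ {Γ φ ψ} → Ax ⊢ (Γ ,, (φ ᴿ)) → Ax ⊢ (Γ ,, (ψ ᴿ))
             → Ax ⊢ (Γ ,, ((φ ∧ ψ) ᴿ))
  leftOr   : ∀ {Γ φ ψ} → Ax ⊢ (Γ ,, (φ ᴸ)) → Ax ⊢ (Γ ,, (ψ ᴸ))
             → Ax ⊢ (Γ ,, ((φ ∨ ψ) ᴸ))
  rightOr  : ∀ {Γ φ ψ} → Ax ⊢ (Γ ,, (φ ᴿ)) → Ax ⊢ (Γ ,, ((φ ∨ ψ) ᴿ))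
  leftNot  : ∀ {Γ φ} → Ax ⊢ (Γ ,, (φ ᴿ)) → Ax ⊢ (Γ ,, ((¬ᶠ φ) ᴸ))
  rightNot : ∀ {Γ φ} → Ax ⊢ (Γ ,, (φ ᴸ)) → Ax ⊢ (Γ ,, ((¬ᶠ φ) ᴿ))

Ax₁ : Sequent → Sequent → Set
Ax₁ A S = S ≡ A

Ax₂ : Sequent → Sequent → Sequent → Set
Ax₂ A B S = (S ≡ A) ⊎ (S ≡ B)

Inconsistent : Sequent → Sequent → Set
Inconsistent A B = Ax₂ A B ⊢ []

data OccursF (n : ℕ) : Formula → Set where
  var  : OccursF n (var n)
  ∧ˡ   : ∀ {φ ψ} → OccursF n φ → OccursF n (φ ∧ ψ)
  ∧ʳ   : ∀ {φ ψ} → OccursF n ψ → OccursF n (φ ∧ ψ)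
  ∨ˡ   : ∀ {φ ψ} → OccursF n φ → OccursF n (φ ∨ ψ)
  ∨ʳ   : ∀ {φ ψ} → OccursF n ψ → OccursF n (φ ∨ ψ)
  ¬o   : ∀ {φ} → OccursF n φ → OccursF n (¬ᶠ φ)

data OccursA (n : ℕ) : Ann → Set where
  inL : ∀ {φ} → OccursF n φ → OccursA n (φ ᴸ)
  inR : ∀ {φ} → OccursF n φ → OccursA n (φ ᴿ)

data Occurs (n : ℕ) : Sequent → Set where
  here  : ∀ {a S} → OccursA n a → Occurs n (a ∷ S)
  there : ∀ {a S} → Occurs n S → Occurs n (a ∷ S)

record RefInterpolant (A B I : Sequent) : Set where
  field
    isSeq     : IsSequent I
    fromA     : Ax₁ A ⊢ I
    incons    : Inconsistent I B
    varsCommon : ∀ n → Occurs n I → Occurs n A × Occurs n B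

seqA : ℕ → ℕ → Sequent
seqA y z = (((var z ∨ ¬ᶠ var y) ∧ (¬ᶠ var z ∨ ¬ᶠ var y)) ᴿ) ∷ []

seqB : ℕ → ℕ → Sequent
seqB x y = (((var x ∧ var y) ∨ (¬ᶠ var x ∧ var y)) ᴿ) ∷ []

-- B entails y, so ¬y is refutable and A collapses to z ∧ ¬z: the pair is
-- inconsistent. An interpolant could only mention y. In the ortholattice MO₂,
-- putting y = α and z = β makes A true, and hence every sequent derivable
-- from A true. On formulas in y alone, sending α to 1 is a homomorphism, so
-- the interpolant stays true when y = 1. But then B is true too, because
-- x ∨ ¬x = 1. Soundness would then make the empty sequent true, which is
-- impossible.
module Submission where

open import Defs
open import Algebra.Core using (Op₁; Op₂)
open import Data.Bool using (Bool; true; false; T; if_then_else_)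
open import Data.Bool.Properties using (T?)
open import Data.Fin using (Fin; zero; suc)
import Data.Fin.Properties as Fin
open import Data.List using ([]; _∷_; _++_)
open import Data.List.Membership.Propositional using (_∈_)
open import Data.List.Relation.Binary.Subset.Propositional using (_⊆_)
open import Data.List.Relation.Binary.Subset.Propositional.Properties using (xs⊆xs++ys)
open import Data.List.Relation.Unary.Any using (here; there)
open import Data.Maybe using (nothing; just)
open import Data.Nat using (ℕ; s≤s; z≤n)
import Data.Nat as ℕ
open import Data.Product using (Σ; ∃; ∃₂; _×_; _,_)
open import Data.Sum using (_⊎_; inj₁; inj₂)
open import Function using (_∘_)
import Level
open import Relation.Binary.Definitions using (Maximum; Minimum)
open import Relation.Binary.Lattice using (BoundedLattice; Infimum; Supremum)
open import Relation.Binary.PropositionalEquality using (_≡_; _≢_; refl)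
import Relation.Binary.PropositionalEquality as ≡
open import Relation.Binary.Structures using (IsPartialOrder)
open import Relation.Nullary using (¬_; Dec; contradiction; does)
open import Relation.Nullary.Decidable using (from-yes; _×-dec_; _→-dec_; dec-true; dec-false)

exchange : ∀ {Ax a b} → Ax ⊢ (a ∷ b ∷ []) → Ax ⊢ (b ∷ a ∷ [])
exchange = conv ((λ _ → swap) , (λ _ → swap))
  where
  swap : ∀ {c a b} → c ∈~ (a ∷ b ∷ []) → c ∈~ (b ∷ a ∷ [])
  swap (here c≈a)         = there (here c≈a)
  swap (there (here c≈b)) = here c≈b

weakenˡ : ∀ {Ax a c} → Ax ⊢ (a ∷ []) → Ax ⊢ (c ∷ a ∷ [])
weakenˡ {a = a} {c} d = exchange (weaken {Γ = just a} {Δ = just c} d)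

leftAndʳ : ∀ {Ax g φ ψ} → Ax ⊢ (g ∷ ψ ᴸ ∷ []) → Ax ⊢ (g ∷ (φ ∧ ψ) ᴸ ∷ [])
leftAndʳ {g = g} d = conv ((λ _ → commute) , (λ _ → commute)) (leftAnd {Γ = just g} d)
  where
  commute : ∀ {c φ ψ} → c ∈~ (g ∷ (φ ∧ ψ) ᴸ ∷ []) → c ∈~ (g ∷ (ψ ∧ φ) ᴸ ∷ [])
  commute (here c≈g)                = here c≈g
  commute (there (here (L~ c~φ∧ψ))) = there (here (L~ (~trans c~φ∧ψ ∧-comm)))

inconsistent-seqA-seqB : ∀ x y z → Inconsistent (seqA y z) (seqB x y)
inconsistent-seqA-seqB x y z =
  cut {Γ = nothing} {Δ = nothing} A
    (cut {Γ = nothing} {Δ = just ((a ∧ b) ᴸ)} A ⊢[a∧b]ᴸ[a∧b]ᴸ)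
  where
  Ax : Sequent → Set
  Ax = Ax₂ (seqA y z) (seqB x y)

  a b : Formula
  a = var z ∨ ¬ᶠ var y
  b = ¬ᶠ var z ∨ ¬ᶠ var y

  A : Ax ⊢ ((a ∧ b) ᴿ ∷ [])
  A = axiom (inj₁ refl)

  ⊢yᴿ : Ax ⊢ (var y ᴿ ∷ [])
  ⊢yᴿ = cut {Γ = nothing} {Δ = just (var y ᴿ)} (axiom (inj₂ refl))
          (exchange (leftOr {Γ = just (var y ᴿ)} (leftAndʳ ⊢yᴿyᴸ) (leftAndʳ ⊢yᴿyᴸ)))
    where
    ⊢yᴿyᴸ : Ax ⊢ (var y ᴿ ∷ var y ᴸ ∷ [])
    ⊢yᴿyᴸ = exchange (hyp (var y))

  ⊢¬yᴸ : Ax ⊢ ((¬ᶠ var y) ᴸ ∷ [])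
  ⊢¬yᴸ = leftNot {Γ = nothing} ⊢yᴿ

  ⊢zᴸbᴸ : Ax ⊢ (var z ᴸ ∷ b ᴸ ∷ [])
  ⊢zᴸbᴸ = leftOr {Γ = just (var z ᴸ)}
            (leftNot {Γ = just (var z ᴸ)} (hyp (var z))) (weakenˡ ⊢¬yᴸ)

  ⊢bᴸaᴸ : Ax ⊢ (b ᴸ ∷ a ᴸ ∷ [])
  ⊢bᴸaᴸ = leftOr {Γ = just (b ᴸ)} (exchange ⊢zᴸbᴸ) (weakenˡ ⊢¬yᴸ)

  ⊢[a∧b]ᴸ[a∧b]ᴸ : Ax ⊢ ((a ∧ b) ᴸ ∷ (a ∧ b) ᴸ ∷ [])
  ⊢[a∧b]ᴸ[a∧b]ᴸ = leftAndʳ (exchange (leftAnd {Γ = just (b ᴸ)} ⊢bᴸaᴸ))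

record Ortholattice c ℓ₁ ℓ₂ : Set (Level.suc (c Level.⊔ ℓ₁ Level.⊔ ℓ₂)) where
  field
    boundedLattice : BoundedLattice c ℓ₁ ℓ₂

  open BoundedLattice boundedLattice public
    renaming (_∧_ to infixr 7 _⊓_; _∨_ to infixr 6 _⊔_)

  infix 10 _ᶜ
  field
    _ᶜ           : Op₁ Carrier
    ᶜ-antitone   : ∀ {x y} → x ≤ y → y ᶜ ≤ x ᶜ
    ᶜ-involutive : ∀ x → x ᶜ ᶜ ≈ x
    x⊓xᶜ≤⊥       : ∀ x → x ⊓ x ᶜ ≤ ⊥

module OrtholatticeProperties {c ℓ₁ ℓ₂} (O : Ortholattice c ℓ₁ ℓ₂) where
  open Ortholattice O renaming (refl to ≤-refl)
  open import Relation.Binary.Reasoning.PartialOrder poset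

  ᶜ-cong : ∀ {x y} → x ≈ y → x ᶜ ≈ y ᶜ
  ᶜ-cong x≈y = antisym (ᶜ-antitone (reflexive (Eq.sym x≈y))) (ᶜ-antitone (reflexive x≈y))

  x≤xᶜᶜ : ∀ x → x ≤ x ᶜ ᶜ
  x≤xᶜᶜ x = reflexive (Eq.sym (ᶜ-involutive x))

  xᶜᶜ≤x : ∀ x → x ᶜ ᶜ ≤ x
  xᶜᶜ≤x x = reflexive (ᶜ-involutive x)

  ᶜ≤⇒ᶜ≤ : ∀ {x y} → x ᶜ ≤ y → y ᶜ ≤ x
  ᶜ≤⇒ᶜ≤ {x} xᶜ≤y = trans (ᶜ-antitone xᶜ≤y) (xᶜᶜ≤x x)

  ≤ᶜ⇒≤ᶜ : ∀ {x y} → x ≤ y ᶜ → y ≤ x ᶜ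
  ≤ᶜ⇒≤ᶜ {y = y} x≤yᶜ = trans (x≤xᶜᶜ y) (ᶜ-antitone x≤yᶜ)

  ᶜ≤⇒maximum : ∀ {x} → x ᶜ ≤ x → Maximum _≤_ x
  ᶜ≤⇒maximum {x} xᶜ≤x y = begin
    y      ≤⟨ maximum y ⟩
    ⊤      ≤⟨ ≤ᶜ⇒≤ᶜ (minimum (⊤ ᶜ)) ⟩
    ⊥ ᶜ    ≤⟨ ᶜ≤⇒ᶜ≤ (trans (∧-greatest xᶜ≤x ≤-refl) (x⊓xᶜ≤⊥ x)) ⟩
    x      ∎

  xᶜ⊓yᶜ≤[x⊔y]ᶜ : ∀ x y → x ᶜ ⊓ y ᶜ ≤ (x ⊔ y) ᶜ
  xᶜ⊓yᶜ≤[x⊔y]ᶜ x y =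
    ≤ᶜ⇒≤ᶜ (∨-least (≤ᶜ⇒≤ᶜ (x∧y≤x (x ᶜ) (y ᶜ))) (≤ᶜ⇒≤ᶜ (x∧y≤y (x ᶜ) (y ᶜ))))

≈ᴬ-refl : ∀ {a} → a ≈ᴬ a
≈ᴬ-refl {φ ᴸ} = L~ ~refl
≈ᴬ-refl {φ ᴿ} = R~ ~refl

∈⇒∈~ : ∀ {a S} → a ∈ S → a ∈~ S
∈⇒∈~ (here refl) = here ≈ᴬ-refl
∈⇒∈~ (there a∈S) = there (∈⇒∈~ a∈S)

∈~⇒∈ : ∀ {a S} → a ∈~ S → ∃ λ b → b ∈ S × a ≈ᴬ b
∈~⇒∈ (here {b} a≈b) = b , here refl , a≈b
∈~⇒∈ (there a∈~S) with ∈~⇒∈ a∈~S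
... | b , b∈S , a≈b = b , there b∈S , a≈b

module Semantics {c ℓ₁ ℓ₂} (O : Ortholattice c ℓ₁ ℓ₂) (v : ℕ → Ortholattice.Carrier O) where
  open Ortholattice O renaming (refl to ≤-refl)
  open OrtholatticeProperties O
  open import Relation.Binary.Lattice.Properties.JoinSemilattice joinSemilattice
    using () renaming (∨-comm to ⊔-comm; ∨-cong to ⊔-cong)
  open import Relation.Binary.Lattice.Properties.MeetSemilattice meetSemilattice
    using () renaming (∧-comm to ⊓-comm; ∧-cong to ⊓-cong)

  ⟦_⟧ : Formula → Carrier
  ⟦ var n ⟧ = v n
  ⟦ 𝟘 ⟧     = ⊥
  ⟦ 𝟙 ⟧     = ⊤
  ⟦ φ ∧ ψ ⟧ = ⟦ φ ⟧ ⊓ ⟦ ψ ⟧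
  ⟦ φ ∨ ψ ⟧ = ⟦ φ ⟧ ⊔ ⟦ ψ ⟧
  ⟦ ¬ᶠ φ ⟧  = ⟦ φ ⟧ ᶜ

  ⟦_⟧ᴬ : Ann → Carrier
  ⟦ φ ᴸ ⟧ᴬ = ⟦ φ ⟧ ᶜ
  ⟦ φ ᴿ ⟧ᴬ = ⟦ φ ⟧

  ⟦_⟧ᴳ : Ctx → Carrier
  ⟦ nothing ⟧ᴳ = ⊥
  ⟦ just a ⟧ᴳ  = ⟦ a ⟧ᴬ

  -- A sequent is read as the disjunction of its members: it holds when two
  -- of them (possibly equal) satisfy ⟦ a ⟧ᴬ ᶜ ≤ ⟦ b ⟧ᴬ. For a = b this says
  -- ⟦ a ⟧ᴬ = ⊤, and the empty sequent never holds.
  Valid : Sequent → Set ℓ₂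
  Valid S = ∃₂ λ a b → a ∈ S × b ∈ S × ⟦ a ⟧ᴬ ᶜ ≤ ⟦ b ⟧ᴬ

  ⟦⟧-cong : ∀ {φ ψ} → φ ~ ψ → ⟦ φ ⟧ ≈ ⟦ ψ ⟧
  ⟦⟧-cong ~refl           = Eq.refl
  ⟦⟧-cong (~sym e)        = Eq.sym (⟦⟧-cong e)
  ⟦⟧-cong (~trans e e′)   = Eq.trans (⟦⟧-cong e) (⟦⟧-cong e′)
  ⟦⟧-cong (∧-comm {φ} {ψ}) = ⊓-comm ⟦ φ ⟧ ⟦ ψ ⟧
  ⟦⟧-cong (∨-comm {φ} {ψ}) = ⊔-comm ⟦ φ ⟧ ⟦ ψ ⟧
  ⟦⟧-cong (∧-cong e e′)   = ⊓-cong (⟦⟧-cong e) (⟦⟧-cong e′)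
  ⟦⟧-cong (∨-cong e e′)   = ⊔-cong (⟦⟧-cong e) (⟦⟧-cong e′)
  ⟦⟧-cong (¬-cong e)      = ᶜ-cong (⟦⟧-cong e)

  ⟦⟧ᴬ-cong : ∀ {a b} → a ≈ᴬ b → ⟦ a ⟧ᴬ ≈ ⟦ b ⟧ᴬ
  ⟦⟧ᴬ-cong (L~ e) = ᶜ-cong (⟦⟧-cong e)
  ⟦⟧ᴬ-cong (R~ e) = ⟦⟧-cong e

  ¬Valid[] : ¬ Valid []
  ¬Valid[] (_ , _ , () , _)

  Valid-⊆ : ∀ {S T} → S ⊆ T → Valid S → Valid T
  Valid-⊆ S⊆T (a , b , a∈S , b∈S , a≤b) = a , b , S⊆T a∈S , S⊆T b∈S , a≤b

  Valid-⊆~ : ∀ {S T} → (∀ a → a ∈~ S → a ∈~ T) → Valid S → Valid T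
  Valid-⊆~ S⊆T (a , b , a∈S , b∈S , a≤b)
    with ∈~⇒∈ (S⊆T a (∈⇒∈~ a∈S)) | ∈~⇒∈ (S⊆T b (∈⇒∈~ b∈S))
  ... | a′ , a′∈T , a≈a′ | b′ , b′∈T , b≈b′ =
    a′ , b′ , a′∈T , b′∈T , ≤-respʳ-≈ (⟦⟧ᴬ-cong b≈b′) (≤-respˡ-≈ (ᶜ-cong (⟦⟧ᴬ-cong a≈a′)) a≤b)

  Valid⇒≤ : ∀ Γ Δ → Valid (⌊ Γ ⌋ ++ ⌊ Δ ⌋) → ⟦ Γ ⟧ᴳ ᶜ ≤ ⟦ Δ ⟧ᴳ
  Valid⇒≤ nothing  nothing  valid = contradiction valid ¬Valid[]
  Valid⇒≤ nothing  (just d) (_ , _ , here refl , here refl , dᶜ≤d) = ᶜ≤⇒maximum dᶜ≤d _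
  Valid⇒≤ (just g) nothing  (_ , _ , here refl , here refl , gᶜ≤g) =
    ᶜ≤⇒ᶜ≤ (ᶜ≤⇒maximum gᶜ≤g _)
  Valid⇒≤ (just g) (just d) (_ , _ , here refl , here refl , gᶜ≤g) =
    trans (ᶜ≤⇒ᶜ≤ (ᶜ≤⇒maximum gᶜ≤g (⊥ ᶜ))) (minimum _)
  Valid⇒≤ (just g) (just d) (_ , _ , here refl , there (here refl) , gᶜ≤d) = gᶜ≤d
  Valid⇒≤ (just g) (just d) (_ , _ , there (here refl) , here refl , dᶜ≤g) = ᶜ≤⇒ᶜ≤ dᶜ≤g
  Valid⇒≤ (just g) (just d) (_ , _ , there (here refl) , there (here refl) , dᶜ≤d) =
    ᶜ≤⇒maximum dᶜ≤d _

  module _ (⊤≰⊥ : ¬ ⊤ ≤ ⊥) where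

    ≤⇒Valid : ∀ Γ Δ → ⟦ Γ ⟧ᴳ ᶜ ≤ ⟦ Δ ⟧ᴳ → Valid (⌊ Γ ⌋ ++ ⌊ Δ ⌋)
    ≤⇒Valid nothing  nothing  ⊥ᶜ≤⊥ =
      contradiction (trans (≤ᶜ⇒≤ᶜ (minimum (⊤ ᶜ))) ⊥ᶜ≤⊥) ⊤≰⊥
    ≤⇒Valid nothing  (just d) ⊥ᶜ≤d =
      d , d , here refl , here refl , trans (maximum _) (trans (≤ᶜ⇒≤ᶜ (minimum (⊤ ᶜ))) ⊥ᶜ≤d)
    ≤⇒Valid (just g) nothing  gᶜ≤⊥ = g , g , here refl , here refl , trans gᶜ≤⊥ (minimum _)
    ≤⇒Valid (just g) (just d) gᶜ≤d = g , d , here refl , there (here refl) , gᶜ≤d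

    Valid-,,-mono : ∀ Γ {a b} → ⟦ a ⟧ᴬ ≤ ⟦ b ⟧ᴬ → Valid (Γ ,, a) → Valid (Γ ,, b)
    Valid-,,-mono Γ {a} {b} a≤b valid =
      ≤⇒Valid Γ (just b) (trans (Valid⇒≤ Γ (just a) valid) a≤b)

    Valid-,,-⊓ : ∀ Γ {a a′ b} → ⟦ a ⟧ᴬ ⊓ ⟦ a′ ⟧ᴬ ≤ ⟦ b ⟧ᴬ →
                 Valid (Γ ,, a) → Valid (Γ ,, a′) → Valid (Γ ,, b)
    Valid-,,-⊓ Γ {a} {a′} {b} a⊓a′≤b valid valid′ =
      ≤⇒Valid Γ (just b)
        (trans (∧-greatest (Valid⇒≤ Γ (just a) valid) (Valid⇒≤ Γ (just a′) valid′)) a⊓a′≤b)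

    sound : ∀ {Ax} → (∀ {S} → Ax S → Valid S) → ∀ {S} → Ax ⊢ S → Valid S
    sound axioms (axiom S∈Ax) = axioms S∈Ax
    sound axioms (conv (S⊆T , _) d) = Valid-⊆~ S⊆T (sound axioms d)
    sound axioms (hyp φ) = ≤⇒Valid (just (φ ᴸ)) (just (φ ᴿ)) (xᶜᶜ≤x ⟦ φ ⟧)
    sound axioms (cut {Γ} {Δ} {ψ} d e) =
      ≤⇒Valid Γ Δ (begin
        ⟦ Γ ⟧ᴳ ᶜ  ≤⟨ Valid⇒≤ Γ (just (ψ ᴿ)) (sound axioms d) ⟩
        ⟦ ψ ⟧     ≤⟨ x≤xᶜᶜ ⟦ ψ ⟧ ⟩
        ⟦ ψ ⟧ ᶜ ᶜ ≤⟨ Valid⇒≤ (just (ψ ᴸ)) Δ (sound axioms e) ⟩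
        ⟦ Δ ⟧ᴳ    ∎)
      where open import Relation.Binary.Reasoning.PartialOrder poset
    sound axioms (weaken {Γ} {Δ} d) = Valid-⊆ (xs⊆xs++ys ⌊ Γ ⌋ ⌊ Δ ⌋) (sound axioms d)
    sound axioms (leftAnd {Γ} {φ} {ψ} d) =
      Valid-,,-mono Γ (ᶜ-antitone (x∧y≤x ⟦ φ ⟧ ⟦ ψ ⟧)) (sound axioms d)
    sound axioms (rightAnd {Γ} d e) = Valid-,,-⊓ Γ ≤-refl (sound axioms d) (sound axioms e)
    sound axioms (leftOr {Γ} {φ} {ψ} d e) =
      Valid-,,-⊓ Γ (xᶜ⊓yᶜ≤[x⊔y]ᶜ ⟦ φ ⟧ ⟦ ψ ⟧) (sound axioms d) (sound axioms e)
    sound axioms (rightOr {Γ} {φ} {ψ} d) = Valid-,,-mono Γ (x≤x∨y ⟦ φ ⟧ ⟦ ψ ⟧) (sound axioms d)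
    sound axioms (leftNot {Γ} {φ} d) = Valid-,,-mono Γ (x≤xᶜᶜ ⟦ φ ⟧) (sound axioms d)
    sound axioms (rightNot {Γ} d) = Valid-,,-mono Γ ≤-refl (sound axioms d)

Occurs-∈ : ∀ {n a S} → a ∈ S → OccursA n a → Occurs n S
Occurs-∈ (here refl) n∈a = here n∈a
Occurs-∈ (there a∈S) n∈a = there (Occurs-∈ a∈S n∈a)

-- For instance the graph of a homomorphism defined only on a subalgebra.
record IsSimulation {c ℓ₁ ℓ₂ c′ ℓ₁′ ℓ₂′ r}
  (O : Ortholattice c ℓ₁ ℓ₂) (O′ : Ortholattice c′ ℓ₁′ ℓ₂′)
  (R : Ortholattice.Carrier O → Ortholattice.Carrier O′ → Set r)
  : Set (c Level.⊔ ℓ₂ Level.⊔ c′ Level.⊔ ℓ₂′ Level.⊔ r) where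
  private
    module L  = Ortholattice O
    module L′ = Ortholattice O′
  field
    ⊥-sim : R L.⊥ L′.⊥
    ⊤-sim : R L.⊤ L′.⊤
    ⊓-sim : ∀ {x x′ y y′} → R x x′ → R y y′ → R (x L.⊓ y) (x′ L′.⊓ y′)
    ⊔-sim : ∀ {x x′ y y′} → R x x′ → R y y′ → R (x L.⊔ y) (x′ L′.⊔ y′)
    ᶜ-sim : ∀ {x x′} → R x x′ → R (x L.ᶜ) (x′ L′.ᶜ)
    ≤-sim : ∀ {x x′ y y′} → R x x′ → R y y′ → x L.≤ y → x′ L′.≤ y′

module _ {c ℓ₁ ℓ₂ c′ ℓ₁′ ℓ₂′ r}
  {O : Ortholattice c ℓ₁ ℓ₂} {O′ : Ortholattice c′ ℓ₁′ ℓ₂′}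
  {R : Ortholattice.Carrier O → Ortholattice.Carrier O′ → Set r}
  (sim : IsSimulation O O′ R)
  {v : ℕ → Ortholattice.Carrier O} {v′ : ℕ → Ortholattice.Carrier O′} where

  open IsSimulation sim
  private
    module M  = Semantics O v
    module M′ = Semantics O′ v′

  ⟦⟧-sim : ∀ φ → (∀ n → OccursF n φ → R (v n) (v′ n)) → R M.⟦ φ ⟧ M′.⟦ φ ⟧
  ⟦⟧-sim (var n) R-vars = R-vars n var
  ⟦⟧-sim 𝟘       R-vars = ⊥-sim
  ⟦⟧-sim 𝟙       R-vars = ⊤-sim
  ⟦⟧-sim (φ ∧ ψ) R-vars =
    ⊓-sim (⟦⟧-sim φ (λ n → R-vars n ∘ ∧ˡ)) (⟦⟧-sim ψ (λ n → R-vars n ∘ ∧ʳ))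
  ⟦⟧-sim (φ ∨ ψ) R-vars =
    ⊔-sim (⟦⟧-sim φ (λ n → R-vars n ∘ ∨ˡ)) (⟦⟧-sim ψ (λ n → R-vars n ∘ ∨ʳ))
  ⟦⟧-sim (¬ᶠ φ)  R-vars = ᶜ-sim (⟦⟧-sim φ (λ n → R-vars n ∘ ¬o))

  ⟦⟧ᴬ-sim : ∀ a → (∀ n → OccursA n a → R (v n) (v′ n)) → R M.⟦ a ⟧ᴬ M′.⟦ a ⟧ᴬ
  ⟦⟧ᴬ-sim (φ ᴸ) R-vars = ᶜ-sim (⟦⟧-sim φ (λ n → R-vars n ∘ inL))
  ⟦⟧ᴬ-sim (φ ᴿ) R-vars = ⟦⟧-sim φ (λ n → R-vars n ∘ inR)

  Valid-sim : ∀ {S} → (∀ n → Occurs n S → R (v n) (v′ n)) → M.Valid S → M′.Valid S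
  Valid-sim {S} R-vars (a , b , a∈S , b∈S , aᶜ≤b) =
    a , b , a∈S , b∈S , ≤-sim (ᶜ-sim (R-at a∈S)) (R-at b∈S) aᶜ≤b
    where
    R-at : ∀ {a} → a ∈ S → R M.⟦ a ⟧ᴬ M′.⟦ a ⟧ᴬ
    R-at {a} a∈S = ⟦⟧ᴬ-sim a (λ n → R-vars n ∘ Occurs-∈ a∈S)

-- MO₂ has the two orthogonal pairs α, α′ and β, β′ strictly between 0ᴹ and 1ᴹ.
-- It is encoded as Fin 6 so that its laws can be checked by exhaustive search.
module MO₂ where

  Carrier : Set
  Carrier = Fin 6

  pattern 0ᴹ = zero
  pattern α  = suc zero
  pattern α′ = suc (suc zero)
  pattern β  = suc (suc (suc zero))
  pattern β′ = suc (suc (suc (suc zero)))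
  pattern 1ᴹ = suc (suc (suc (suc (suc zero))))

  leq : Carrier → Carrier → Bool
  leq 0ᴹ _  = true
  leq _  1ᴹ = true
  leq α  α  = true
  leq α′ α′ = true
  leq β  β  = true
  leq β′ β′ = true
  leq _  _  = false

  infix 4 _≤_
  _≤_ : Carrier → Carrier → Set
  x ≤ y = T (leq x y)

  infix 4 _≤?_
  _≤?_ : ∀ x y → Dec (x ≤ y)
  x ≤? y = T? (leq x y)

  infixr 7 _⊓_
  infixr 6 _⊔_
  _⊓_ _⊔_ : Op₂ Carrier
  x ⊓ y = if leq x y then x else if leq y x then y else 0ᴹ
  x ⊔ y = if leq x y then y else if leq y x then x else 1ᴹ

  infix 10 _ᶜ
  _ᶜ : Op₁ Carrier
  0ᴹ ᶜ = 1ᴹ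
  α  ᶜ = α′
  α′ ᶜ = α
  β  ᶜ = β′
  β′ ᶜ = β
  1ᴹ ᶜ = 0ᴹ

  ≤-refl : ∀ x → x ≤ x
  ≤-refl = from-yes (Fin.all? λ x → x ≤? x)

  ≤-trans : ∀ x y z → x ≤ y → y ≤ z → x ≤ z
  ≤-trans = from-yes (Fin.all? λ x → Fin.all? λ y → Fin.all? λ z →
    x ≤? y →-dec y ≤? z →-dec x ≤? z)

  ≤-antisym : ∀ x y → x ≤ y → y ≤ x → x ≡ y
  ≤-antisym = from-yes (Fin.all? λ x → Fin.all? λ y →
    x ≤? y →-dec y ≤? x →-dec x Fin.≟ y)

  ⊓-infimum : Infimum _≤_ _⊓_
  ⊓-infimum = from-yes (Fin.all? λ x → Fin.all? λ y →
    x ⊓ y ≤? x ×-dec x ⊓ y ≤? y ×-dec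
    Fin.all? λ z → z ≤? x →-dec z ≤? y →-dec z ≤? x ⊓ y)

  ⊔-supremum : Supremum _≤_ _⊔_
  ⊔-supremum = from-yes (Fin.all? λ x → Fin.all? λ y →
    x ≤? x ⊔ y ×-dec y ≤? x ⊔ y ×-dec
    Fin.all? λ z → x ≤? z →-dec y ≤? z →-dec x ⊔ y ≤? z)

  1ᴹ-maximum : Maximum _≤_ 1ᴹ
  1ᴹ-maximum = from-yes (Fin.all? λ x → x ≤? 1ᴹ)

  0ᴹ-minimum : Minimum _≤_ 0ᴹ
  0ᴹ-minimum = from-yes (Fin.all? λ x → 0ᴹ ≤? x)

  ᶜ-antitone : ∀ x y → x ≤ y → y ᶜ ≤ x ᶜ
  ᶜ-antitone = from-yes (Fin.all? λ x → Fin.all? λ y → x ≤? y →-dec y ᶜ ≤? x ᶜ)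

  ᶜ-involutive : ∀ x → x ᶜ ᶜ ≡ x
  ᶜ-involutive = from-yes (Fin.all? λ x → x ᶜ ᶜ Fin.≟ x)

  x⊓xᶜ≤0ᴹ : ∀ x → x ⊓ x ᶜ ≤ 0ᴹ
  x⊓xᶜ≤0ᴹ = from-yes (Fin.all? λ x → x ⊓ x ᶜ ≤? 0ᴹ)

  1≰0 : ¬ 1ᴹ ≤ 0ᴹ
  1≰0 ()

  ≤-isPartialOrder : IsPartialOrder _≡_ _≤_
  ≤-isPartialOrder = record
    { isPreorder = record
      { isEquivalence = ≡.isEquivalence
      ; reflexive     = λ { {x} refl → ≤-refl x }
      ; trans         = λ {x} {y} {z} → ≤-trans x y z
      }
    ; antisym = λ {x} {y} → ≤-antisym x y
    }

  ortholattice : Ortholattice Level.zero Level.zero Level.zero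
  ortholattice = record
    { boundedLattice = record
      { _≈_              = _≡_
      ; _≤_              = _≤_
      ; _∨_              = _⊔_
      ; _∧_              = _⊓_
      ; ⊤                = 1ᴹ
      ; ⊥                = 0ᴹ
      ; isBoundedLattice = record
        { isLattice = record
          { isPartialOrder = ≤-isPartialOrder
          ; supremum       = ⊔-supremum
          ; infimum        = ⊓-infimum
          }
        ; maximum = 1ᴹ-maximum
        ; minimum = 0ᴹ-minimum
        }
      }
    ; _ᶜ           = _ᶜ
    ; ᶜ-antitone   = λ {x} {y} → ᶜ-antitone x y
    ; ᶜ-involutive = ᶜ-involutive
    ; x⊓xᶜ≤⊥       = x⊓xᶜ≤0ᴹ
    }

  -- The graph of the homomorphism from the subalgebra {0ᴹ, α, α′, 1ᴹ} onto
  -- {0ᴹ, 1ᴹ} that sends α to 1ᴹ.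
  collapses : Carrier → Carrier → Bool
  collapses 0ᴹ 0ᴹ = true
  collapses α  1ᴹ = true
  collapses α′ 0ᴹ = true
  collapses 1ᴹ 1ᴹ = true
  collapses _  _  = false

  Collapse : Carrier → Carrier → Set
  Collapse x y = T (collapses x y)

  collapse-isSimulation : IsSimulation ortholattice ortholattice Collapse
  collapse-isSimulation = record
    { ⊥-sim = _
    ; ⊤-sim = _
    ; ⊓-sim = λ {x} {x′} {y} {y′} → ⊓-sim x x′ y y′
    ; ⊔-sim = λ {x} {x′} {y} {y′} → ⊔-sim x x′ y y′
    ; ᶜ-sim = λ {x} {x′} → ᶜ-sim x x′
    ; ≤-sim = λ {x} {x′} {y} {y′} → ≤-sim x x′ y y′
    }
    where
    C? : ∀ x y → Dec (Collapse x y)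
    C? x y = T? (collapses x y)
    ⊓-sim : ∀ x x′ y y′ → Collapse x x′ → Collapse y y′ → Collapse (x ⊓ y) (x′ ⊓ y′)
    ⊓-sim = from-yes (Fin.all? λ x → Fin.all? λ x′ → Fin.all? λ y → Fin.all? λ y′ →
      C? x x′ →-dec C? y y′ →-dec C? (x ⊓ y) (x′ ⊓ y′))
    ⊔-sim : ∀ x x′ y y′ → Collapse x x′ → Collapse y y′ → Collapse (x ⊔ y) (x′ ⊔ y′)
    ⊔-sim = from-yes (Fin.all? λ x → Fin.all? λ x′ → Fin.all? λ y → Fin.all? λ y′ →
      C? x x′ →-dec C? y y′ →-dec C? (x ⊔ y) (x′ ⊔ y′))
    ᶜ-sim : ∀ x x′ → Collapse x x′ → Collapse (x ᶜ) (x′ ᶜ)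
    ᶜ-sim = from-yes (Fin.all? λ x → Fin.all? λ x′ → C? x x′ →-dec C? (x ᶜ) (x′ ᶜ))
    ≤-sim : ∀ x x′ y y′ → Collapse x x′ → Collapse y y′ → x ≤ y → x′ ≤ y′
    ≤-sim = from-yes (Fin.all? λ x → Fin.all? λ x′ → Fin.all? λ y → Fin.all? λ y′ →
      C? x x′ →-dec C? y y′ →-dec x ≤? y →-dec x′ ≤? y′)

occurs-seqA : ∀ {n y z} → Occurs n (seqA y z) → n ≡ y ⊎ n ≡ z
occurs-seqA (here (inR (∧ˡ (∨ˡ var))))        = inj₂ refl
occurs-seqA (here (inR (∧ˡ (∨ʳ (¬o var)))))   = inj₁ refl
occurs-seqA (here (inR (∧ʳ (∨ˡ (¬o var)))))   = inj₂ refl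
occurs-seqA (here (inR (∧ʳ (∨ʳ (¬o var)))))   = inj₁ refl

occurs-seqB : ∀ {n x y} → Occurs n (seqB x y) → n ≡ x ⊎ n ≡ y
occurs-seqB (here (inR (∨ˡ (∧ˡ var))))        = inj₁ refl
occurs-seqB (here (inR (∨ˡ (∧ʳ var))))        = inj₂ refl
occurs-seqB (here (inR (∨ʳ (∧ˡ (¬o var)))))   = inj₁ refl
occurs-seqB (here (inR (∨ʳ (∧ʳ var))))        = inj₂ refl

common-variable≡y : ∀ {n x y z} → x ≢ z → Occurs n (seqA y z) × Occurs n (seqB x y) → n ≡ y
common-variable≡y x≢z (n∈A , n∈B) with occurs-seqA n∈A | occurs-seqB n∈B
... | inj₁ n≡y   | _          = n≡y
... | inj₂ _     | inj₂ n≡y   = n≡y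
... | inj₂ refl  | inj₁ refl  = contradiction refl x≢z

module _ where
  open MO₂
  private
    module Model = Semantics ortholattice

  seqA-holds : ∀ {v : ℕ → Carrier} {y z} → v y ≡ α → v z ≡ β → Model.Valid v (seqA y z)
  seqA-holds {v} {y} {z} vy≡α vz≡β = Model.≤⇒Valid v 1≰0 nothing (just _) 1≤A
    where
    1≤A : 1ᴹ ≤ (v z ⊔ v y ᶜ) ⊓ (v z ᶜ ⊔ v y ᶜ)
    1≤A rewrite vy≡α | vz≡β = _

  seqB-holds : ∀ {x y} → Model.Valid (λ _ → 1ᴹ) (seqB x y)
  seqB-holds = Model.≤⇒Valid _ 1≰0 nothing (just _) _

  no-interpolant-seqA-seqB : ∀ {x y z} → y ≢ z → x ≢ z →
                             ¬ Σ Sequent (RefInterpolant (seqA y z) (seqB x y))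
  no-interpolant-seqA-seqB {x} {y} {z} y≢z x≢z (I , I-interpolates) =
    Model.¬Valid[] v₂ (Model.sound v₂ 1≰0 I,B-hold incons)
    where
    open RefInterpolant I-interpolates

    v₁ v₂ : ℕ → Carrier
    v₁ n = if does (n ℕ.≟ z) then β else α
    v₂ _ = 1ᴹ

    v₁y≡α : v₁ y ≡ α
    v₁y≡α rewrite dec-false (y ℕ.≟ z) y≢z = refl

    v₁z≡β : v₁ z ≡ β
    v₁z≡β rewrite dec-true (z ℕ.≟ z) refl = refl

    I-holds₁ : Model.Valid v₁ I
    I-holds₁ = Model.sound v₁ 1≰0 (λ { refl → seqA-holds v₁y≡α v₁z≡β }) fromA

    v₁-collapses-on-I : ∀ n → Occurs n I → Collapse (v₁ n) (v₂ n)
    v₁-collapses-on-I n n∈I with common-variable≡y x≢z (varsCommon n n∈I)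
    ... | refl rewrite v₁y≡α = _

    I,B-hold : ∀ {S} → Ax₂ I (seqB x y) S → Model.Valid v₂ S
    I,B-hold (inj₁ refl) =
      Valid-sim collapse-isSimulation {v = v₁} {v′ = v₂} v₁-collapses-on-I I-holds₁
    I,B-hold (inj₂ refl) = seqB-holds

theorem3 : (x y z : ℕ) → x ≢ y → y ≢ z → x ≢ z →
    (Inconsistent (seqA y z) (seqB x y)
      × ¬ Σ Sequent (RefInterpolant (seqA y z) (seqB x y)))
    × ¬ ((A B : Sequent) → IsSequent A → IsSequent B → Inconsistent A B →
          Σ Sequent (RefInterpolant A B))
theorem3 x y z _ y≢z x≢z =
  (inconsistent-seqA-seqB x y z , no-interpolant-seqA-seqB y≢z x≢z) ,
  λ interpolate → no-interpolant-seqA-seqB y≢z x≢z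
    (interpolate (seqA y z) (seqB x y) (s≤s z≤n) (s≤s z≤n) (inconsistent-seqA-seqB x y z))
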